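{- Let $a\geq 4$ and $m$ be integers with $2a+2\leq m\leq a^2-a$, let $C(m,a)=\left\lceil\frac{m-1}{a}\left\lceil\frac{m-1}{a}\right\rceil\right\rceil$, and suppose $\{1,\dots,C(m,a)\}$ is colored red and blue so that there is no solution of $x_1+\cdots+x_{m-1}=ax_m$ with all $x_i\in\{1,\dots,C(m,a)\}$ of the same color, and so that $1$ is red. If $1$ and $2$ are both red, then $C(m,a)$ is red.
   Context: Solutions need not have distinct entries. -}

module Defs where

open import Data.Nat using (ℕ; zero; suc; _+_; _*_; _∸_; _≤_; _/_)
open import Data.Bool using (Bool; true; false)
open import Data.Vec using (Vec; sum)
open import Data.Vec.Relation.Unary.All using (All)
open import Data.Product using (_×_; Σ-syntax)
open import Relation.Binary.PropositionalEquality using (_≡_)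

-- ceiling division ⌈ n / a ⌉ for a ≥ 1 (value 0 when a = 0, never used)
ceilDiv : ℕ → ℕ → ℕ
ceilDiv n zero = 0
ceilDiv n (suc k) = (n + k) / suc k

-- C(m,a) = ⌈ (m-1)/a * ⌈ (m-1)/a ⌉ ⌉ = ⌈ (m-1) ⌈(m-1)/a⌉ / a ⌉
C : ℕ → ℕ → ℕ
C m a = ceilDiv ((m ∸ 1) * ceilDiv (m ∸ 1) a) a

-- a colouring: true = red, false = blue
Colouring : Set
Colouring = ℕ → Bool

InRangeCol : Colouring → ℕ → Bool → ℕ → Set
InRangeCol c N b x = (1 ≤ x) × (x ≤ N) × (c x ≡ b)

MonoSolution : Colouring → ℕ → ℕ → ℕ → Set
MonoSolution c m a N =
  Σ[ b ∈ Bool ] Σ[ xs ∈ Vec ℕ (m ∸ 1) ] Σ[ y ∈ ℕ ]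
    (All (InRangeCol c N b) xs × InRangeCol c N b y × (sum xs ≡ a * y))

module Submission where

open import Defs
open import Data.Nat using (ℕ; _+_; _*_; _∸_; _≤_; zero; suc; z≤n; s≤s; s≤s⁻¹; _%_)
open import Data.Nat.Properties
open import Data.Nat.DivMod using (m≡m%n+[m/n]*n; m%n<n; m/n*n≤m)
open import Data.Bool using (true; false)
open import Data.Vec using (Vec; []; _∷_; sum)
open import Data.Vec.Relation.Unary.All using (All; []; _∷_)
open import Data.Product using (_×_; _,_)
open import Data.Empty using (⊥; ⊥-elim)
open import Relation.Nullary using (¬_)
open import Relation.Binary.PropositionalEquality using (_≡_; refl; sym; trans; cong; module ≡-Reasoning)

-- Proof idea (k = m − 1, t = ⌈k/a⌉, N = C(m,a) = ⌈kt/a⌉).  A sum of k terms,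
-- each equal to p or p + 1, can be any number in [kp, kp + k]; so whenever
-- p, p + 1 and y share a colour and a·y lies in that window, we get a
-- monochromatic solution.  With 1, 2 red: a·t and a·(t + 1) lie in [k, 2k],
-- so t and t + 1 are blue; then a·N lies in [kt, kt + k], so N is red.

balancedVec : (k j p : ℕ) → Vec ℕ k
balancedVec zero    j       p = []
balancedVec (suc k) zero    p = p ∷ balancedVec k zero p
balancedVec (suc k) (suc j) p = suc p ∷ balancedVec k j p

sum-balancedVec : ∀ k j p → j ≤ k → sum (balancedVec k j p) ≡ k * p + j
sum-balancedVec zero    .zero p z≤n = refl
sum-balancedVec (suc k) zero  p _   = begin
  p + sum (balancedVec k zero p) ≡⟨ cong (p +_) (sum-balancedVec k zero p z≤n) ⟩
  p + (k * p + 0)                ≡⟨ sym (+-assoc p (k * p) 0) ⟩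
  p + k * p + 0                  ∎
  where open ≡-Reasoning
sum-balancedVec (suc k) (suc j) p (s≤s j≤k) = begin
  suc p + sum (balancedVec k j p) ≡⟨ cong (suc p +_) (sum-balancedVec k j p j≤k) ⟩
  suc (p + (k * p + j))           ≡⟨ cong suc (sym (+-assoc p (k * p) j)) ⟩
  suc (p + k * p + j)             ≡⟨ sym (+-suc (p + k * p) j) ⟩
  p + k * p + suc j               ∎
  where open ≡-Reasoning

All-balancedVec : ∀ {P : ℕ → Set} k j p → P p → P (suc p) → All P (balancedVec k j p)
All-balancedVec zero    j       p Pp Pp+1 = []
All-balancedVec (suc k) zero    p Pp Pp+1 = Pp ∷ All-balancedVec k zero p Pp Pp+1
All-balancedVec (suc k) (suc j) p Pp Pp+1 = Pp+1 ∷ All-balancedVec k j p Pp Pp+1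

InWindow : ℕ → ℕ → ℕ → Set
InWindow k p s = k * p ≤ s × s ≤ k * p + k

inWindow⇒monoSolution : ∀ {c N b k a} p y →
  InRangeCol c N b p → InRangeCol c N b (suc p) → InRangeCol c N b y →
  InWindow k p (a * y) → MonoSolution c (suc k) a N
inWindow⇒monoSolution {b = b} {k} {a} p y p∈ p+1∈ y∈ (lo , hi) =
  b , balancedVec k j p , y , All-balancedVec k j p p∈ p+1∈ , y∈ ,
  trans (sum-balancedVec k j p (m≤n+o⇒m∸n≤o (a * y) (k * p) hi)) (m+[n∸m]≡n lo)
  where j = a * y ∸ k * p

ceilDiv-lower : ∀ n a → n ≤ suc a * ceilDiv n (suc a)
ceilDiv-lower n a = +-cancelʳ-≤ a n (suc a * q) (begin
  n + a                          ≡⟨ m≡m%n+[m/n]*n (n + a) (suc a) ⟩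
  (n + a) % suc a + q * suc a    ≤⟨ +-monoˡ-≤ (q * suc a) (s≤s⁻¹ (m%n<n (n + a) (suc a))) ⟩
  a + q * suc a                  ≡⟨ +-comm a (q * suc a) ⟩
  q * suc a + a                  ≡⟨ cong (_+ a) (*-comm q (suc a)) ⟩
  suc a * q + a                  ∎)
  where
  open ≤-Reasoning
  q = ceilDiv n (suc a)

ceilDiv-upper : ∀ n a → suc a * ceilDiv n (suc a) ≤ n + a
ceilDiv-upper n a = begin
  suc a * ceilDiv n (suc a) ≡⟨ *-comm (suc a) (ceilDiv n (suc a)) ⟩
  ceilDiv n (suc a) * suc a ≤⟨ m/n*n≤m (n + a) (suc a) ⟩
  n + a                     ∎
  where open ≤-Reasoning

1≤k≤m*n⇒1≤n : ∀ m {k n} → 1 ≤ k → k ≤ m * n → 1 ≤ n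
1≤k≤m*n⇒1≤n m {n = zero}  1≤k k≤m*0 = ≤-trans 1≤k (≤-trans k≤m*0 (≤-reflexive (*-zeroʳ m)))
1≤k≤m*n⇒1≤n m {n = suc _} _   _      = s≤s z≤n

unitWindow : ∀ {k s} → k ≤ s → s ≤ k + k → InWindow k 1 s
unitWindow {k} lo hi rewrite *-identityʳ k = lo , hi

module _ (a k : ℕ) (2A≤k : suc a + suc a ≤ k) where
  private
    A = suc a
    t = ceilDiv k A
    N = C (suc k) A

    A+a≤k : A + a ≤ k
    A+a≤k = ≤-trans (+-monoʳ-≤ A (n≤1+n a)) 2A≤k

    a≤k : a ≤ k
    a≤k = ≤-trans (m≤n+m a A) A+a≤k

    1≤t : 1 ≤ t
    1≤t = 1≤k≤m*n⇒1≤n A (≤-trans (s≤s z≤n) 2A≤k) (ceilDiv-lower k a)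

    k≤At : k ≤ A * t
    k≤At = ceilDiv-lower k a

    At≤k+a : A * t ≤ k + a
    At≤k+a = ceilDiv-upper k a

    kt≤AN : k * t ≤ A * N
    kt≤AN = ceilDiv-lower (k * t) a

    AN≤kt+a : A * N ≤ k * t + a
    AN≤kt+a = ceilDiv-upper (k * t) a

    t+1≤N : suc t ≤ N
    t+1≤N = *-cancelˡ-≤ A (begin
      A * suc t     ≡⟨ *-suc A t ⟩
      A + A * t     ≤⟨ +-monoˡ-≤ (A * t) A≤At ⟩
      A * t + A * t ≡⟨ sym (*-distribʳ-+ t A A) ⟩
      (A + A) * t   ≤⟨ *-monoˡ-≤ t 2A≤k ⟩
      k * t         ≤⟨ kt≤AN ⟩
      A * N         ∎)
      where
      open ≤-Reasoning
      A≤At : A ≤ A * t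
      A≤At = ≤-trans (≤-reflexive (sym (*-identityʳ A))) (*-monoʳ-≤ A 1≤t)

    t≤N : t ≤ N
    t≤N = ≤-trans (n≤1+n t) t+1≤N

    1≤N : 1 ≤ N
    1≤N = ≤-trans 1≤t t≤N

    1∈ : ∀ c → c 1 ≡ true → InRangeCol c N true 1
    1∈ c c1 = s≤s z≤n , 1≤N , c1

    2∈ : ∀ c → c 2 ≡ true → InRangeCol c N true 2
    2∈ c c2 = s≤s z≤n , ≤-trans (s≤s 1≤t) t+1≤N , c2

    window-t : InWindow k 1 (A * t)
    window-t = unitWindow k≤At (≤-trans At≤k+a (+-monoʳ-≤ k a≤k))

    window-t+1 : InWindow k 1 (A * suc t)
    window-t+1 = unitWindow (≤-trans k≤At (*-monoʳ-≤ A (n≤1+n t))) (begin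
      A * suc t     ≡⟨ *-suc A t ⟩
      A + A * t     ≤⟨ +-monoʳ-≤ A At≤k+a ⟩
      A + (k + a)   ≡⟨ cong (A +_) (+-comm k a) ⟩
      A + (a + k)   ≡⟨ sym (+-assoc A a k) ⟩
      A + a + k     ≤⟨ +-monoˡ-≤ k A+a≤k ⟩
      k + k         ∎)
      where open ≤-Reasoning

    window-N : InWindow k t (A * N)
    window-N = kt≤AN , ≤-trans AN≤kt+a (+-monoʳ-≤ (k * t) a≤k)

  red-1-2⇒red-C : (c : Colouring) → ¬ MonoSolution c (suc k) (suc a) (C (suc k) (suc a)) →
    c 1 ≡ true → c 2 ≡ true → c (C (suc k) (suc a)) ≡ true
  red-1-2⇒red-C c noSol c1 c2 with c (C (suc k) (suc a)) in cN | c t in ct | c (suc t) in ct+1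
  ... | true  | _     | _     = refl
  ... | false | true  | _     = ⊥-elim (noSol (inWindow⇒monoSolution {a = A} 1 t
                                  (1∈ c c1) (2∈ c c2) (1≤t , t≤N , ct) window-t))
  ... | false | false | true  = ⊥-elim (noSol (inWindow⇒monoSolution {a = A} 1 (suc t)
                                  (1∈ c c1) (2∈ c c2) (s≤s z≤n , t+1≤N , ct+1) window-t+1))
  ... | false | false | false = ⊥-elim (noSol (inWindow⇒monoSolution {a = A} t N
                                  (1≤t , t≤N , ct) (s≤s z≤n , t+1≤N , ct+1) (1≤N , ≤-refl , cN) window-N))

lemma8 : (a m : ℕ) → 4 ≤ a → 2 * a + 2 ≤ m → m ≤ a * a ∸ a →
    (c : Colouring) → ¬ MonoSolution c m a (C m a) →
    c 1 ≡ true → c 2 ≡ true → c (C m a) ≡ true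
lemma8 zero    _       ()  _       _
lemma8 (suc a) zero    _   ()      _
lemma8 (suc a) (suc k) _   2A+2≤m _ = red-1-2⇒red-C a k (≤-trans (n≤1+n _) (s≤s⁻¹ 2A+2≤m′))
  where
  2A+2≤m′ : 2 + (suc a + suc a) ≤ suc k
  2A+2≤m′ rewrite sym (+-identityʳ (suc a)) | +-comm 2 (2 * suc a) = 2A+2≤m
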